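{- Let $G=(V_1\cup V_2,E)$ be a bipartite graph whose maximum matching has cardinality $\kappa$. Let $M_g$ be a maximal matching of $G$ (one to which no edge of $E$ can be added) with $\kappa_g=|M_g|$ edges, and let $V_g$ be the set of $2\kappa_g$ endpoints of edges of $M_g$. For $v\in V_g$, let $E_g(v)$ be the set of edges of $E$ joining $v$ to another node of $V_g$. For each $v\in V_g$ define an edge set $F(v)$: if $v$ has degree at most $2\kappa_g$ in $G$, $F(v)$ is the set of all edges incident to $v$; otherwise $F(v)$ consists of all edges of $E_g(v)$ together with an arbitrary subset of $2\kappa_g-|E_g(v)|$ further edges incident to $v$ not in $E_g(v)$. Let $E^*=\bigcup_{v\in V_g}F(v)$ and $G^*=(V_1\cup V_2,E^*)$. Then a maximum matching in $G^*$ has cardinality $\kappa$.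
   Context: A matching is a set of edges no two of which share an endpoint. -}

module Defs where

open import Data.Nat using (ℕ; zero; suc; _+_; _*_; _∸_; _≤_; _<_)
open import Data.Bool using (Bool; true; false; _∧_; _∨_; not; if_then_else_)
open import Data.Fin using (Fin; zero; suc; _≟_)
open import Data.Sum using (_⊎_; inj₁; inj₂)
open import Data.Product using (_×_)
import Data.Product
import Data.Empty
open import Relation.Binary.PropositionalEquality using (_≡_)
open import Relation.Nullary.Decidable using (⌊_⌋)

-- A bipartite graph G = (V₁ ∪ V₂, E) with V₁ = Fin n₁, V₂ = Fin n₂.
-- Every edge joins some i ∈ V₁ to some j ∈ V₂; a set of edges is given by
-- its (decidable) indicator function.
EdgeSet : ℕ → ℕ → Set
EdgeSet n₁ n₂ = Fin n₁ → Fin n₂ → Bool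

Vertex : ℕ → ℕ → Set
Vertex n₁ n₂ = Fin n₁ ⊎ Fin n₂

countFin : ∀ {n} → (Fin n → Bool) → ℕ
countFin {zero} f = 0
countFin {suc n} f = (if f zero then 1 else 0) + countFin (λ k → f (suc k))

sumFin : ∀ {n} → (Fin n → ℕ) → ℕ
sumFin {zero} f = 0
sumFin {suc n} f = f zero + sumFin (λ k → f (suc k))

anyFin : ∀ {n} → (Fin n → Bool) → Bool
anyFin {zero} f = false
anyFin {suc n} f = f zero ∨ anyFin (λ k → f (suc k))

module _ {n₁ n₂ : ℕ} where

  card : EdgeSet n₁ n₂ → ℕ
  card A = sumFin (λ i → countFin (λ j → A i j))

  _⊆_ : EdgeSet n₁ n₂ → EdgeSet n₁ n₂ → Set
  A ⊆ B = ∀ i j → A i j ≡ true → B i j ≡ true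

  _≐_ : EdgeSet n₁ n₂ → EdgeSet n₁ n₂ → Set
  A ≐ B = ∀ i j → A i j ≡ B i j

  _∖_ : EdgeSet n₁ n₂ → EdgeSet n₁ n₂ → EdgeSet n₁ n₂
  (A ∖ B) i j = A i j ∧ not (B i j)

  insert : EdgeSet n₁ n₂ → Fin n₁ → Fin n₂ → EdgeSet n₁ n₂
  insert M i j i' j' = M i' j' ∨ (⌊ i ≟ i' ⌋ ∧ ⌊ j ≟ j' ⌋)

  IsMatching : EdgeSet n₁ n₂ → EdgeSet n₁ n₂ → Set
  IsMatching E M =
    (M ⊆ E)
    × (∀ i j j' → M i j ≡ true → M i j' ≡ true → j ≡ j')
    × (∀ i i' j → M i j ≡ true → M i' j ≡ true → i ≡ i')

  MaxMatchingCard : EdgeSet n₁ n₂ → ℕ → Set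
  MaxMatchingCard E κ =
    (Data.Product.Σ (EdgeSet n₁ n₂) λ M → IsMatching E M × card M ≡ κ)
    × (∀ M → IsMatching E M → card M ≤ κ)

  IsMaximalMatching : EdgeSet n₁ n₂ → EdgeSet n₁ n₂ → Set
  IsMaximalMatching E M =
    IsMatching E M
    × (∀ i j → E i j ≡ true → M i j ≡ false → (IsMatching E (insert M i j) → Data.Empty.⊥))

  -- v is an endpoint of an edge of M (v ∈ V_g)
  covered : EdgeSet n₁ n₂ → Vertex n₁ n₂ → Bool
  covered M (inj₁ i) = anyFin (λ j → M i j)
  covered M (inj₂ j) = anyFin (λ i → M i j)

  incident : Vertex n₁ n₂ → Fin n₁ → Fin n₂ → Bool
  incident (inj₁ i) i' j' = ⌊ i ≟ i' ⌋
  incident (inj₂ j) i' j' = ⌊ j ≟ j' ⌋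

  edgesAt : EdgeSet n₁ n₂ → Vertex n₁ n₂ → EdgeSet n₁ n₂
  edgesAt E v i j = E i j ∧ incident v i j

  degree : EdgeSet n₁ n₂ → Vertex n₁ n₂ → ℕ
  degree E v = card (edgesAt E v)

  Eg : EdgeSet n₁ n₂ → EdgeSet n₁ n₂ → Vertex n₁ n₂ → EdgeSet n₁ n₂
  Eg E M (inj₁ i) i' j = edgesAt E (inj₁ i) i' j ∧ covered M (inj₂ j)
  Eg E M (inj₂ j) i j' = edgesAt E (inj₂ j) i j' ∧ covered M (inj₁ i)

  ValidF : EdgeSet n₁ n₂ → EdgeSet n₁ n₂ → Vertex n₁ n₂ → EdgeSet n₁ n₂ → Set
  ValidF E M v Fv =
    (degree E v ≤ 2 * card M → Fv ≐ edgesAt E v)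
    × (2 * card M < degree E v →
        (Eg E M v ⊆ Fv)
        × ((Fv ∖ Eg E M v) ⊆ edgesAt E v)
        × (card (Fv ∖ Eg E M v) ≡ 2 * card M ∸ card (Eg E M v)))

  Estar : EdgeSet n₁ n₂ → (Vertex n₁ n₂ → EdgeSet n₁ n₂) → EdgeSet n₁ n₂
  Estar M F i j =
    anyFin (λ i' → covered M (inj₁ i') ∧ F (inj₁ i') i j)
    ∨ anyFin (λ j' → covered M (inj₂ j') ∧ F (inj₂ j') i j)

-- Every edge of G meets V_g, since M_g is maximal, and a matching meets each vertex of V_g
-- at most once; hence every matching of G has at most 2κ_g edges. If an edge (i , j) of G is
-- missing from E*, one of its endpoints v ∈ V_g has degree > 2κ_g, so F(v) gives v at least
-- 2κ_g ≥ |M| neighbours in G* for any matching M of G. At most |M| - 1 of them are covered by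
-- the other edges of M, so if (i , j) ∈ M, it can be exchanged for an edge of G* from v to an
-- uncovered vertex. Each exchange keeps |M| and decreases |M ∖ E*|, so repeating it moves a
-- maximum matching of G into G*.
module Submission where

open import Defs
open import Data.Nat using (ℕ; zero; suc; _+_; _*_; _∸_; _≤_; _<_; z≤n; s≤s; _≤?_)
open import Data.Nat.Properties hiding (_≟_; suc-injective)
open import Data.Nat.Induction using (<-wellFounded)
open import Algebra.Properties.CommutativeSemigroup +-commutativeSemigroup using (interchange)
open import Data.Bool using (Bool; true; false; _∧_; _∨_; not; if_then_else_)
open import Data.Bool.Properties using () renaming (_≟_ to _≟ᵇ_)
open import Data.Fin using (Fin; zero; suc; _≟_)
open import Data.Fin.Properties using (any?; suc-injective)
open import Data.Sum using (_⊎_; inj₁; inj₂)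
open import Data.Product using (_×_; _,_; Σ; proj₁; proj₂)
open import Data.Empty using (⊥; ⊥-elim)
open import Function using (_∘_)
open import Induction.WellFounded using (Acc; acc)
open import Relation.Nullary using (yes; no; ¬_)
open import Relation.Nullary.Decidable using (⌊_⌋; _×-dec_)
open import Relation.Binary.PropositionalEquality

private
  variable
    n n₁ n₂ : ℕ

𝟙 : Bool → ℕ
𝟙 b = if b then 1 else 0

∧-true⁻ : ∀ {a b} → a ∧ b ≡ true → a ≡ true × b ≡ true
∧-true⁻ {true} {true} _ = refl , refl

∧-true⁺ : ∀ {a b} → a ≡ true → b ≡ true → a ∧ b ≡ true
∧-true⁺ refl refl = refl

∨-true⁻ : ∀ {a b} → a ∨ b ≡ true → a ≡ true ⊎ b ≡ true
∨-true⁻ {true} _ = inj₁ refl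
∨-true⁻ {false} p = inj₂ p

∨-trueˡ : ∀ {a} b → a ≡ true → a ∨ b ≡ true
∨-trueˡ b refl = refl

∨-trueʳ : ∀ a {b} → b ≡ true → a ∨ b ≡ true
∨-trueʳ true _ = refl
∨-trueʳ false p = p

true≢false : ∀ {b} → b ≡ true → b ≡ false → ⊥
true≢false refl ()

≢false⇒true : ∀ {b} → ¬ b ≡ false → b ≡ true
≢false⇒true {true} _ = refl
≢false⇒true {false} b≢false = ⊥-elim (b≢false refl)

≟-true⁻ : {i j : Fin n} → ⌊ i ≟ j ⌋ ≡ true → i ≡ j
≟-true⁻ {i = i} {j} p with i ≟ j
... | yes i≡j = i≡j

≟-refl : (i : Fin n) → ⌊ i ≟ i ⌋ ≡ true
≟-refl i with i ≟ i
... | yes _ = refl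
... | no i≢i = ⊥-elim (i≢i refl)

𝟙≤1 : ∀ b → 𝟙 b ≤ 1
𝟙≤1 true = ≤-refl
𝟙≤1 false = z≤n

𝟙-mono : ∀ {a b} → (a ≡ true → b ≡ true) → 𝟙 a ≤ 𝟙 b
𝟙-mono {false} _ = z≤n
𝟙-mono {true} a⇒b rewrite a⇒b refl = ≤-refl

𝟙-split : ∀ a b → 𝟙 a ≡ 𝟙 (a ∧ b) + 𝟙 (a ∧ not b)
𝟙-split true true = refl
𝟙-split true false = refl
𝟙-split false _ = refl

-- Sums, counts and existence over Fin n

sumFin-cong : {f g : Fin n → ℕ} → (∀ k → f k ≡ g k) → sumFin f ≡ sumFin g
sumFin-cong {zero} _ = refl
sumFin-cong {suc n} f≗g = cong₂ _+_ (f≗g zero) (sumFin-cong (λ k → f≗g (suc k)))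

sumFin-mono-≤ : {f g : Fin n → ℕ} → (∀ k → f k ≤ g k) → sumFin f ≤ sumFin g
sumFin-mono-≤ {zero} _ = z≤n
sumFin-mono-≤ {suc n} f≤g = +-mono-≤ (f≤g zero) (sumFin-mono-≤ (λ k → f≤g (suc k)))

sumFin-mono-< : {f g : Fin n → ℕ} → (∀ k → f k ≤ g k) → (i : Fin n) → f i < g i →
                sumFin f < sumFin g
sumFin-mono-< {suc n} f≤g zero fi<gi = +-mono-<-≤ fi<gi (sumFin-mono-≤ (λ k → f≤g (suc k)))
sumFin-mono-< {suc n} f≤g (suc i) fi<gi =
  +-mono-≤-< (f≤g zero) (sumFin-mono-< (λ k → f≤g (suc k)) i fi<gi)

sumFin-+ : (f g : Fin n → ℕ) → sumFin (λ k → f k + g k) ≡ sumFin f + sumFin g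
sumFin-+ {zero} _ _ = refl
sumFin-+ {suc n} f g =
  trans (cong (f zero + g zero +_) (sumFin-+ (λ k → f (suc k)) (λ k → g (suc k))))
        (interchange (f zero) (g zero) _ _)

sumFin-zero : sumFin {n} (λ _ → 0) ≡ 0
sumFin-zero {zero} = refl
sumFin-zero {suc n} = sumFin-zero {n}

sumFin-comm : (h : Fin n₁ → Fin n₂ → ℕ) →
              sumFin (λ i → sumFin (h i)) ≡ sumFin (λ j → sumFin (λ i → h i j))
sumFin-comm {zero} {n₂} _ = sym (sumFin-zero {n₂})
sumFin-comm {suc n₁} h =
  trans (cong (sumFin (h zero) +_) (sumFin-comm (λ i → h (suc i))))
        (sym (sumFin-+ (h zero) (λ j → sumFin (λ i → h (suc i) j))))

sumFin-single : (h : Fin n → ℕ) (i : Fin n) → (∀ k → ¬ k ≡ i → h k ≡ 0) → sumFin h ≡ h i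
sumFin-single {suc n} h zero off-i =
  trans (cong (h zero +_) (trans (sumFin-cong (λ k → off-i (suc k) λ ())) (sumFin-zero {n})))
        (+-identityʳ _)
sumFin-single {suc n} h (suc i) off-i =
  trans (cong (_+ sumFin (λ k → h (suc k))) (off-i zero λ ()))
        (sumFin-single (λ k → h (suc k)) i (λ k k≢i → off-i (suc k) (k≢i ∘ suc-injective)))

countFin-sum : (f : Fin n → Bool) → countFin f ≡ sumFin (λ k → 𝟙 (f k))
countFin-sum {zero} _ = refl
countFin-sum {suc n} f = cong (𝟙 (f zero) +_) (countFin-sum (λ k → f (suc k)))

countFin-cong : {f g : Fin n → Bool} → (∀ k → f k ≡ g k) → countFin f ≡ countFin g
countFin-cong {zero} _ = refl
countFin-cong {suc n} f≗g = cong₂ _+_ (cong 𝟙 (f≗g zero)) (countFin-cong (λ k → f≗g (suc k)))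

countFin-split : (f g : Fin n → Bool) →
  countFin f ≡ countFin (λ k → f k ∧ g k) + countFin (λ k → f k ∧ not (g k))
countFin-split {zero} _ _ = refl
countFin-split {suc n} f g =
  trans (cong₂ _+_ (𝟙-split (f zero) (g zero)) (countFin-split (λ k → f (suc k)) (λ k → g (suc k))))
        (interchange (𝟙 (f zero ∧ g zero)) (𝟙 (f zero ∧ not (g zero))) _ _)

countFin-mono : {f g : Fin n → Bool} → (∀ k → f k ≡ true → g k ≡ true) → countFin f ≤ countFin g
countFin-mono {zero} _ = z≤n
countFin-mono {suc n} f⇒g = +-mono-≤ (𝟙-mono (f⇒g zero)) (countFin-mono (λ k → f⇒g (suc k)))

countFin-mono-< : {f g : Fin n → Bool} → (∀ k → f k ≡ true → g k ≡ true) →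
                  (j : Fin n) → f j ≡ false → g j ≡ true → countFin f < countFin g
countFin-mono-< {suc n} {f} {g} f⇒g zero fj gj rewrite fj | gj =
  s≤s (countFin-mono (λ k → f⇒g (suc k)))
countFin-mono-< {suc n} {f} {g} f⇒g (suc j) fj gj =
  subst (_≤ countFin g) (+-suc (𝟙 (f zero)) _)
        (+-mono-≤ (𝟙-mono (f⇒g zero)) (countFin-mono-< (λ k → f⇒g (suc k)) j fj gj))

countFin-zero : {f : Fin n → Bool} → (∀ k → f k ≡ false) → countFin f ≡ 0
countFin-zero {zero} _ = refl
countFin-zero {suc n} {f} f≡false rewrite f≡false zero = countFin-zero (λ k → f≡false (suc k))

anyFin-intro : {f : Fin n → Bool} (k : Fin n) → f k ≡ true → anyFin f ≡ true
anyFin-intro {suc n} {f} zero fk = ∨-trueˡ _ fk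
anyFin-intro {suc n} {f} (suc k) fk = ∨-trueʳ (f zero) (anyFin-intro k fk)

anyFin-elim : {f : Fin n → Bool} → anyFin f ≡ true → Σ (Fin n) λ k → f k ≡ true
anyFin-elim {suc n} {f} p with ∨-true⁻ {f zero} p
... | inj₁ f0 = zero , f0
... | inj₂ rest with anyFin-elim rest
...   | k , fk = suc k , fk

anyFin-false : {f : Fin n → Bool} → anyFin f ≡ false → ∀ k → f k ≡ false
anyFin-false {f = f} none k with f k in fk
... | true = ⊥-elim (true≢false (anyFin-intro k fk) none)
... | false = refl

AtMostOne : (Fin n → Bool) → Set
AtMostOne f = ∀ a b → f a ≡ true → f b ≡ true → a ≡ b

countFin-atMostOne : {f : Fin n → Bool} → AtMostOne f → countFin f ≡ 𝟙 (anyFin f)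
countFin-atMostOne {zero} _ = refl
countFin-atMostOne {suc n} {f} unique with f zero in f0
... | true = cong suc (countFin-zero rest-false)
  where
  rest-false : ∀ k → f (suc k) ≡ false
  rest-false k with f (suc k) in fk
  ... | true with () ← unique zero (suc k) f0 fk
  ... | false = refl
... | false = countFin-atMostOne (λ a b fa fb → suc-injective (unique (suc a) (suc b) fa fb))

countFin-atMostOne-≤1 : {f : Fin n → Bool} → AtMostOne f → countFin f ≤ 1
countFin-atMostOne-≤1 {f = f} unique =
  subst (_≤ 1) (sym (countFin-atMostOne unique)) (𝟙≤1 (anyFin f))

countFin-exactlyOne : {f : Fin n → Bool} → AtMostOne f → (j : Fin n) → f j ≡ true → countFin f ≡ 1
countFin-exactlyOne unique j fj = trans (countFin-atMostOne unique) (cong 𝟙 (anyFin-intro j fj))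

_ᵀ : EdgeSet n₁ n₂ → EdgeSet n₂ n₁
(A ᵀ) j i = A i j

card-ᵀ : (A : EdgeSet n₁ n₂) → card (A ᵀ) ≡ card A
card-ᵀ A = begin
  sumFin (λ j → countFin (λ i → A i j))      ≡⟨ sumFin-cong (λ j → countFin-sum (λ i → A i j)) ⟩
  sumFin (λ j → sumFin (λ i → 𝟙 (A i j)))    ≡⟨ sumFin-comm (λ i j → 𝟙 (A i j)) ⟨
  sumFin (λ i → sumFin (λ j → 𝟙 (A i j)))    ≡⟨ sumFin-cong (λ i → countFin-sum (A i)) ⟨
  sumFin (λ i → countFin (A i))              ∎
  where open ≡-Reasoning

card-mono-< : {A B : EdgeSet n₁ n₂} → A ⊆ B → ∀ i j → A i j ≡ false → B i j ≡ true →
              card A < card B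
card-mono-< A⊆B i j Aij Bij =
  sumFin-mono-< (λ k → countFin-mono (A⊆B k)) i (countFin-mono-< (A⊆B i) j Aij Bij)

card-∖ : (A B : EdgeSet n₁ n₂) → B ⊆ A → card A ≡ card B + card (A ∖ B)
card-∖ A B B⊆A = begin
  sumFin (λ i → countFin (A i))
    ≡⟨ sumFin-cong (λ i → countFin-split (A i) (B i)) ⟩
  sumFin (λ i → countFin (λ j → A i j ∧ B i j) + countFin ((A ∖ B) i))
    ≡⟨ sumFin-+ (λ i → countFin (λ j → A i j ∧ B i j)) (λ i → countFin ((A ∖ B) i)) ⟩
  sumFin (λ i → countFin (λ j → A i j ∧ B i j)) + card (A ∖ B)
    ≡⟨ cong (_+ card (A ∖ B)) (sumFin-cong (λ i → countFin-cong (A∧B≡B i))) ⟩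
  card B + card (A ∖ B) ∎
  where
  open ≡-Reasoning
  A∧B≡B : ∀ i j → A i j ∧ B i j ≡ B i j
  A∧B≡B i j with B i j in Bij
  ... | true rewrite B⊆A i j Bij = refl
  ... | false with A i j
  ...   | true = refl
  ...   | false = refl

card-inRow : (A : EdgeSet n₁ n₂) (i : Fin n₁) → (∀ k y → A k y ≡ true → k ≡ i) →
             card A ≡ countFin (A i)
card-inRow A i inRow = sumFin-single (λ k → countFin (A k)) i
  (λ k k≢i → countFin-zero (λ y → off-row k k≢i y))
  where
  off-row : ∀ k → ¬ k ≡ i → ∀ y → A k y ≡ false
  off-row k k≢i y with A k y in Aky
  ... | true = ⊥-elim (k≢i (inRow k y Aky))
  ... | false = refl

RowUnique ColUnique : EdgeSet n₁ n₂ → Set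
RowUnique M = ∀ i → AtMostOne (M i)
ColUnique M = ∀ j → AtMostOne (λ i → M i j)

card-rowUnique : (M : EdgeSet n₁ n₂) → RowUnique M → card M ≡ countFin (λ i → anyFin (M i))
card-rowUnique M unique =
  trans (sumFin-cong (λ i → countFin-atMostOne (unique i))) (sym (countFin-sum (λ i → anyFin (M i))))

card-colUnique : (M : EdgeSet n₁ n₂) → ColUnique M →
                 card M ≡ countFin (λ j → anyFin (λ i → M i j))
card-colUnique M unique = trans (sym (card-ᵀ M)) (card-rowUnique (M ᵀ) unique)

module _ {E M : EdgeSet n₁ n₂} where

  IsMatching-rowUnique : IsMatching E M → RowUnique M
  IsMatching-rowUnique (_ , rowUnique , _) = rowUnique

  IsMatching-colUnique : IsMatching E M → ColUnique M
  IsMatching-colUnique (_ , _ , colUnique) j i i' = colUnique i i' j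

  IsMatching-ᵀ : IsMatching E M → IsMatching (E ᵀ) (M ᵀ)
  IsMatching-ᵀ (M⊆E , rowUnique , colUnique) =
    (λ j i → M⊆E i j) , (λ j i i' → colUnique i i' j) , (λ j j' i → rowUnique i j j')

  IsMatching-mono : {E' : EdgeSet n₁ n₂} → E ⊆ E' → IsMatching E M → IsMatching E' M
  IsMatching-mono E⊆E' (M⊆E , unique) = (λ i j Mij → E⊆E' i j (M⊆E i j Mij)) , unique

-- The easy half of König's theorem.
matching-card≤cover : {M : EdgeSet n₁ n₂} → RowUnique M → ColUnique M →
  (R : Fin n₁ → Bool) (C : Fin n₂ → Bool) → (∀ i j → M i j ≡ true → R i ≡ true ⊎ C j ≡ true) →
  card M ≤ countFin R + countFin C
matching-card≤cover {M = M} rowUnique colUnique R C covers = begin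
  sumFin (λ i → countFin (M i))
    ≤⟨ sumFin-mono-≤ row-bound ⟩
  sumFin (λ i → 𝟙 (R i) + countFin (MC i))
    ≡⟨ sumFin-+ (λ i → 𝟙 (R i)) (λ i → countFin (MC i)) ⟩
  sumFin (λ i → 𝟙 (R i)) + card MC
    ≡⟨ cong₂ _+_ (sym (countFin-sum R)) (sym (card-ᵀ MC)) ⟩
  countFin R + sumFin (λ j → countFin (λ i → MC i j))
    ≤⟨ +-monoʳ-≤ (countFin R) (sumFin-mono-≤ col-bound) ⟩
  countFin R + sumFin (λ j → 𝟙 (C j))
    ≡⟨ cong (countFin R +_) (countFin-sum C) ⟨
  countFin R + countFin C ∎
  where
  open ≤-Reasoning
  MC : EdgeSet _ _
  MC i j = M i j ∧ C j

  row-bound : ∀ i → countFin (M i) ≤ 𝟙 (R i) + countFin (MC i)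
  row-bound i with R i in Ri
  ... | true = ≤-trans (countFin-atMostOne-≤1 (rowUnique i)) (m≤m+n 1 _)
  ... | false = countFin-mono in-C
    where
    in-C : ∀ j → M i j ≡ true → MC i j ≡ true
    in-C j Mij with covers i j Mij
    ... | inj₁ Ri≡true = ⊥-elim (true≢false Ri≡true Ri)
    ... | inj₂ Cj = ∧-true⁺ Mij Cj

  col-bound : ∀ j → countFin (λ i → MC i j) ≤ 𝟙 (C j)
  col-bound j with C j in Cj
  ... | true = countFin-atMostOne-≤1 (λ a b p q → colUnique j a b (proj₁ (∧-true⁻ p)) (proj₁ (∧-true⁻ q)))
  ... | false = ≤-reflexive (countFin-zero λ i → ∧-false (M i j))
    where
    ∧-false : ∀ b → b ∧ false ≡ false
    ∧-false true = refl
    ∧-false false = refl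

module _ {E M : EdgeSet n₁ n₂} {i : Fin n₁} {j : Fin n₂} where

  insert-elim : ∀ {k y} → insert M i j k y ≡ true → M k y ≡ true ⊎ (i ≡ k × j ≡ y)
  insert-elim {k} {y} p with ∨-true⁻ {M k y} p
  ... | inj₁ Mky = inj₁ Mky
  ... | inj₂ q = inj₂ (≟-true⁻ (proj₁ (∧-true⁻ q)) , ≟-true⁻ (proj₂ (∧-true⁻ q)))

  insert-isMatching : IsMatching E M → E i j ≡ true →
    anyFin (M i) ≡ false → anyFin (λ k → M k j) ≡ false → IsMatching E (insert M i j)
  insert-isMatching (M⊆E , rowUnique , colUnique) Eij i-free j-free =
    insert⊆E , insert-rowUnique , insert-colUnique
    where
    insert⊆E : insert M i j ⊆ E
    insert⊆E k y p with insert-elim p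
    ... | inj₁ Mky = M⊆E k y Mky
    ... | inj₂ (refl , refl) = Eij

    insert-rowUnique : ∀ k y y' → insert M i j k y ≡ true → insert M i j k y' ≡ true → y ≡ y'
    insert-rowUnique k y y' p q with insert-elim p | insert-elim q
    ... | inj₁ Mky | inj₁ Mky' = rowUnique k y y' Mky Mky'
    ... | inj₁ Mky | inj₂ (refl , _) = ⊥-elim (true≢false (anyFin-intro y Mky) i-free)
    ... | inj₂ (refl , _) | inj₁ Mky' = ⊥-elim (true≢false (anyFin-intro y' Mky') i-free)
    ... | inj₂ (_ , j≡y) | inj₂ (_ , j≡y') = trans (sym j≡y) j≡y'

    insert-colUnique : ∀ k k' y → insert M i j k y ≡ true → insert M i j k' y ≡ true → k ≡ k'
    insert-colUnique k k' y p q with insert-elim p | insert-elim q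
    ... | inj₁ Mky | inj₁ Mk'y = colUnique k k' y Mky Mk'y
    ... | inj₁ Mky | inj₂ (_ , refl) = ⊥-elim (true≢false (anyFin-intro k Mky) j-free)
    ... | inj₂ (_ , refl) | inj₁ Mk'y = ⊥-elim (true≢false (anyFin-intro k' Mk'y) j-free)
    ... | inj₂ (i≡k , _) | inj₂ (i≡k' , _) = trans (sym i≡k) i≡k'

-- Exchanging a matching edge for an edge of a subgraph

redirect : EdgeSet n₁ n₂ → Fin n₁ → Fin n₂ → EdgeSet n₁ n₂
redirect M i x k y = if ⌊ i ≟ k ⌋ then ⌊ x ≟ y ⌋ else M k y

module _ {M : EdgeSet n₁ n₂} {i : Fin n₁} {x : Fin n₂} where

  redirect-elim : ∀ {k y} → redirect M i x k y ≡ true → (i ≡ k × x ≡ y) ⊎ (¬ i ≡ k × M k y ≡ true)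
  redirect-elim {k} p with i ≟ k
  ... | yes i≡k = inj₁ (i≡k , ≟-true⁻ p)
  ... | no i≢k = inj₂ (i≢k , p)

  redirect-isMatching : {E : EdgeSet n₁ n₂} → IsMatching E M → E i x ≡ true →
    anyFin (λ k → M k x) ≡ false → IsMatching E (redirect M i x)
  redirect-isMatching {E} (M⊆E , rowUnique , colUnique) Eix x-free =
    redirect⊆E , redirect-rowUnique , redirect-colUnique
    where
    redirect⊆E : redirect M i x ⊆ E
    redirect⊆E k y p with redirect-elim p
    ... | inj₁ (refl , refl) = Eix
    ... | inj₂ (_ , Mky) = M⊆E k y Mky

    redirect-rowUnique : ∀ k y y' → redirect M i x k y ≡ true → redirect M i x k y' ≡ true → y ≡ y'
    redirect-rowUnique k y y' p q with redirect-elim p | redirect-elim q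
    ... | inj₁ (_ , x≡y) | inj₁ (_ , x≡y') = trans (sym x≡y) x≡y'
    ... | inj₁ (i≡k , _) | inj₂ (i≢k , _) = ⊥-elim (i≢k i≡k)
    ... | inj₂ (i≢k , _) | inj₁ (i≡k , _) = ⊥-elim (i≢k i≡k)
    ... | inj₂ (_ , Mky) | inj₂ (_ , Mky') = rowUnique k y y' Mky Mky'

    redirect-colUnique : ∀ k k' y → redirect M i x k y ≡ true → redirect M i x k' y ≡ true → k ≡ k'
    redirect-colUnique k k' y p q with redirect-elim p | redirect-elim q
    ... | inj₁ (i≡k , _) | inj₁ (i≡k' , _) = trans (sym i≡k) i≡k'
    ... | inj₁ (_ , refl) | inj₂ (_ , Mk'x) = ⊥-elim (true≢false (anyFin-intro k' Mk'x) x-free)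
    ... | inj₂ (_ , Mkx) | inj₁ (_ , refl) = ⊥-elim (true≢false (anyFin-intro k Mkx) x-free)
    ... | inj₂ (_ , Mky) | inj₂ (_ , Mk'y) = colUnique k k' y Mky Mk'y

  card-redirect : RowUnique M → {j : Fin n₂} → M i j ≡ true → card (redirect M i x) ≡ card M
  card-redirect rowUnique {j} Mij = sumFin-cong same-row-count
    where
    same-row-count : ∀ k → countFin (redirect M i x k) ≡ countFin (M k)
    same-row-count k with i ≟ k
    ... | yes refl = trans (countFin-exactlyOne (λ a b p q → trans (sym (≟-true⁻ p)) (≟-true⁻ q)) x (≟-refl x))
                           (sym (countFin-exactlyOne (rowUnique i) j Mij))
    ... | no _ = refl

  redirect∖⊆ : {S : EdgeSet n₁ n₂} → S i x ≡ true → (redirect M i x ∖ S) ⊆ (M ∖ S)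
  redirect∖⊆ Six k y p with ∧-true⁻ p
  ... | r , notS with redirect-elim r
  ...   | inj₁ (refl , refl) rewrite Six with () ← notS
  ...   | inj₂ (_ , Mky) = ∧-true⁺ Mky notS

-- Pigeonhole: the |M| vertices covered by M include j, which is not an S-neighbour of i.
uncovered-neighbour : {M S : EdgeSet n₁ n₂} → ColUnique M → ∀ {i j} → M i j ≡ true →
  S i j ≡ false → card M ≤ countFin (S i) →
  Σ (Fin n₂) λ x → S i x ≡ true × anyFin (λ k → M k x) ≡ false
uncovered-neighbour {M = M} {S} colUnique {i} {j} Mij Sij |M|≤deg
  with any? (λ x → (S i x ≟ᵇ true) ×-dec (anyFin (λ k → M k x) ≟ᵇ false))
... | yes found = found
... | no none = ⊥-elim (<-irrefl refl (≤-<-trans |M|≤deg deg<|M|))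
  where
  neighbour-covered : ∀ x → S i x ≡ true → anyFin (λ k → M k x) ≡ true
  neighbour-covered x Six = ≢false⇒true (λ free → none (x , Six , free))
  deg<|M| : countFin (S i) < card M
  deg<|M| = subst (countFin (S i) <_) (sym (card-colUnique M colUnique))
                  (countFin-mono-< neighbour-covered j Sij (anyFin-intro i Mij))

module _ {E S : EdgeSet n₁ n₂} (S⊆E : S ⊆ E) where

  Exchange : EdgeSet n₁ n₂ → Set
  Exchange M = Σ (EdgeSet n₁ n₂) λ M' →
    IsMatching E M' × card M' ≡ card M × card (M' ∖ S) < card (M ∖ S)

  exchange-inRow : ∀ {M} → IsMatching E M → ∀ {i j} → M i j ≡ true → S i j ≡ false →
                   card M ≤ countFin (S i) → Exchange M
  exchange-inRow {M} matching {i} {j} Mij Sij |M|≤deg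
    with uncovered-neighbour {S = S} (IsMatching-colUnique matching) Mij Sij |M|≤deg
  ... | x , Six , x-free =
    redirect M i x ,
    redirect-isMatching matching (S⊆E i x Six) x-free ,
    card-redirect (IsMatching-rowUnique matching) Mij ,
    card-mono-< (redirect∖⊆ {M = M} {i = i} {x = x} {S = S} Six) i j
                ij∉redirect (∧-true⁺ Mij (cong not Sij))
    where
    ij∉redirect : (redirect M i x ∖ S) i j ≡ false
    ij∉redirect with (redirect M i x ∖ S) i j in p
    ... | false = refl
    ... | true with redirect-elim {M = M} {i = i} {x = x} (proj₁ (∧-true⁻ p))
    ...   | inj₁ (_ , refl) = ⊥-elim (true≢false Six Sij)
    ...   | inj₂ (i≢i , _) = ⊥-elim (i≢i refl)

exchange-inCol : {E S : EdgeSet n₁ n₂} (S⊆E : S ⊆ E) → ∀ {M} → IsMatching E M → ∀ {i j} →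
  M i j ≡ true → S i j ≡ false → card M ≤ countFin (λ k → S k j) → Exchange S⊆E M
exchange-inCol {S = S} S⊆E {M} matching Mij Sij |M|≤deg
  with exchange-inRow (λ j i → S⊆E i j) (IsMatching-ᵀ matching) Mij Sij
         (subst (_≤ _) (sym (card-ᵀ M)) |M|≤deg)
... | M' , matching' , |M'|≡|M| , M'∖S<M∖S =
  M' ᵀ , IsMatching-ᵀ matching' ,
  trans (card-ᵀ M') (trans |M'|≡|M| (card-ᵀ M)) ,
  subst₂ _<_ (sym (card-ᵀ (M' ∖ (S ᵀ)))) (card-ᵀ (M ∖ S)) M'∖S<M∖S

matching-into-subgraph : {E S : EdgeSet n₁ n₂} → S ⊆ E → (b : ℕ) →
  (∀ i j → E i j ≡ true → S i j ≡ false → b ≤ countFin (S i) ⊎ b ≤ countFin (λ k → S k j)) →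
  ∀ {M} → IsMatching E M → card M ≤ b →
  Σ (EdgeSet n₁ n₂) λ M' → IsMatching S M' × card M' ≡ card M
matching-into-subgraph {n₁ = n₁} {n₂ = n₂} {E = E} {S} S⊆E b high-degree {M} matching |M|≤b =
  go M (<-wellFounded (card (M ∖ S))) matching |M|≤b
  where
  go : ∀ M → Acc _<_ (card (M ∖ S)) → IsMatching E M → card M ≤ b →
       Σ (EdgeSet n₁ n₂) λ M' → IsMatching S M' × card M' ≡ card M
  go M (acc smaller) matching@(M⊆E , unique) |M|≤b
    with any? (λ i → any? (λ j → (M i j ≟ᵇ true) ×-dec (S i j ≟ᵇ false)))
  ... | no none = M , (M⊆S , unique) , refl
    where
    M⊆S : M ⊆ S
    M⊆S i j Mij = ≢false⇒true (λ Sij → none (i , j , Mij , Sij))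
  ... | yes (i , j , Mij , Sij) with step (high-degree i j (M⊆E i j Mij) Sij)
    where
    step : b ≤ countFin (S i) ⊎ b ≤ countFin (λ k → S k j) → Exchange S⊆E M
    step (inj₁ b≤deg) = exchange-inRow S⊆E matching Mij Sij (≤-trans |M|≤b b≤deg)
    step (inj₂ b≤deg) = exchange-inCol S⊆E matching Mij Sij (≤-trans |M|≤b b≤deg)
  ... | M' , matching' , |M'|≡|M| , closer
    with go M' (smaller closer) matching' (subst (_≤ b) (sym |M'|≡|M|) |M|≤b)
  ...   | M'' , matching'' , |M''|≡|M'| = M'' , matching'' , trans |M''|≡|M'| |M'|≡|M|

-- The sparsified graph G*

module _ {E Mg : EdgeSet n₁ n₂} (maximal : IsMaximalMatching E Mg) where

  edge-meets-Vg : ∀ i j → E i j ≡ true → covered Mg (inj₁ i) ≡ true ⊎ covered Mg (inj₂ j) ≡ true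
  edge-meets-Vg i j Eij with covered Mg (inj₁ i) in i-cov | covered Mg (inj₂ j) in j-cov
  ... | true | _ = inj₁ refl
  ... | false | true = inj₂ refl
  ... | false | false =
    ⊥-elim (proj₂ maximal i j Eij (anyFin-false i-cov j)
                  (insert-isMatching (proj₁ maximal) Eij i-cov j-cov))

  matching-card≤2κg : ∀ {M} → IsMatching E M → card M ≤ 2 * card Mg
  matching-card≤2κg {M} matching@(M⊆E , _) = begin
    card M
      ≤⟨ matching-card≤cover (IsMatching-rowUnique matching) (IsMatching-colUnique matching)
           (λ i → covered Mg (inj₁ i)) (λ j → covered Mg (inj₂ j))
           (λ i j Mij → edge-meets-Vg i j (M⊆E i j Mij)) ⟩
    countFin (λ i → anyFin (Mg i)) + countFin (λ j → anyFin (λ i → Mg i j))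
      ≡⟨ cong₂ _+_ (card-rowUnique Mg (IsMatching-rowUnique Mg-matching))
                   (trans (*-identityˡ (card Mg)) (card-colUnique Mg (IsMatching-colUnique Mg-matching))) ⟨
    2 * card Mg ∎
    where
    open ≤-Reasoning
    Mg-matching : IsMatching E Mg
    Mg-matching = proj₁ maximal

  module _ (F : Vertex n₁ n₂ → EdgeSet n₁ n₂)
           (valid : ∀ v → covered Mg v ≡ true → ValidF E Mg v (F v)) where

    F⊆Estar : ∀ v → covered Mg v ≡ true → F v ⊆ Estar Mg F
    F⊆Estar (inj₁ i') v-cov i j p = ∨-trueˡ _ (anyFin-intro i' (∧-true⁺ v-cov p))
    F⊆Estar (inj₂ j') v-cov i j p = ∨-trueʳ _ (anyFin-intro j' (∧-true⁺ v-cov p))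

    F⊆edgesAt : ∀ v → covered Mg v ≡ true → F v ⊆ edgesAt E v
    F⊆edgesAt v v-cov i j p with degree E v ≤? 2 * card Mg
    ... | yes low = subst (_≡ true) (proj₁ (valid v v-cov) low i j) p
    ... | no high with proj₂ (valid v v-cov) (≰⇒> high) | Eg E Mg v i j in Eg-ij
    ...   | _ , Fv∖Eg⊆edgesAt , _ | false = Fv∖Eg⊆edgesAt i j (∧-true⁺ p (cong not Eg-ij))
    ...   | _ | true = Eg⊆edgesAt v Eg-ij
      where
      Eg⊆edgesAt : ∀ v → Eg E Mg v i j ≡ true → edgesAt E v i j ≡ true
      Eg⊆edgesAt (inj₁ _) q = proj₁ (∧-true⁻ q)
      Eg⊆edgesAt (inj₂ _) q = proj₁ (∧-true⁻ q)

    Estar-elim : ∀ {i j} → Estar Mg F i j ≡ true →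
                 Σ (Vertex n₁ n₂) λ v → covered Mg v ≡ true × F v i j ≡ true
    Estar-elim {i} {j} p with ∨-true⁻ {anyFin (λ i' → covered Mg (inj₁ i') ∧ F (inj₁ i') i j)} p
    ... | inj₁ q = let i' , r = anyFin-elim {f = λ i' → covered Mg (inj₁ i') ∧ F (inj₁ i') i j} q
                   in inj₁ i' , ∧-true⁻ r
    ... | inj₂ q = let j' , r = anyFin-elim {f = λ j' → covered Mg (inj₂ j') ∧ F (inj₂ j') i j} q
                   in inj₂ j' , ∧-true⁻ r

    Estar⊆E : Estar Mg F ⊆ E
    Estar⊆E i j p with Estar-elim p
    ... | v , v-cov , Fvij = proj₁ (∧-true⁻ (F⊆edgesAt v v-cov i j Fvij))

    -- A missing edge at v rules out the case F(v) = all edges at v; in the other case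
    -- |F(v)| = |E_g(v)| + (2κ_g ∸ |E_g(v)|) ≥ 2κ_g.
    F-large : ∀ v → covered Mg v ≡ true → ∀ {i j} → edgesAt E v i j ≡ true →
              Estar Mg F i j ≡ false → 2 * card Mg ≤ card (F v)
    F-large v v-cov {i} {j} ij-at-v ij-missing with degree E v ≤? 2 * card Mg
    ... | yes low =
      ⊥-elim (true≢false (F⊆Estar v v-cov i j (trans (proj₁ (valid v v-cov) low i j) ij-at-v)) ij-missing)
    ... | no high with proj₂ (valid v v-cov) (≰⇒> high)
    ...   | Eg⊆Fv , _ , |Fv∖Eg| = begin
      2 * card Mg                                         ≤⟨ m≤n+m∸n (2 * card Mg) (card (Eg E Mg v)) ⟩
      card (Eg E Mg v) + (2 * card Mg ∸ card (Eg E Mg v)) ≡⟨ cong (card (Eg E Mg v) +_) |Fv∖Eg| ⟨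
      card (Eg E Mg v) + card (F v ∖ Eg E Mg v)           ≡⟨ card-∖ (F v) (Eg E Mg v) Eg⊆Fv ⟨
      card (F v)                                          ∎
      where open ≤-Reasoning

    Estar-dense : ∀ i j → E i j ≡ true → Estar Mg F i j ≡ false →
      2 * card Mg ≤ countFin (Estar Mg F i) ⊎ 2 * card Mg ≤ countFin (λ k → Estar Mg F k j)
    Estar-dense i j Eij ij-missing with edge-meets-Vg i j Eij
    ... | inj₁ i-cov = inj₁ (begin
      2 * card Mg                ≤⟨ F-large (inj₁ i) i-cov (∧-true⁺ Eij (≟-refl i)) ij-missing ⟩
      card (F (inj₁ i))          ≡⟨ card-inRow (F (inj₁ i)) i in-row-i ⟩
      countFin (F (inj₁ i) i)    ≤⟨ countFin-mono (F⊆Estar (inj₁ i) i-cov i) ⟩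
      countFin (Estar Mg F i)    ∎)
      where
      open ≤-Reasoning
      in-row-i : ∀ k y → F (inj₁ i) k y ≡ true → k ≡ i
      in-row-i k y p = sym (≟-true⁻ (proj₂ (∧-true⁻ (F⊆edgesAt (inj₁ i) i-cov k y p))))
    ... | inj₂ j-cov = inj₂ (begin
      2 * card Mg                        ≤⟨ F-large (inj₂ j) j-cov (∧-true⁺ Eij (≟-refl j)) ij-missing ⟩
      card (F (inj₂ j))                  ≡⟨ card-ᵀ (F (inj₂ j)) ⟨
      card (F (inj₂ j) ᵀ)                ≡⟨ card-inRow (F (inj₂ j) ᵀ) j in-col-j ⟩
      countFin (λ k → F (inj₂ j) k j)    ≤⟨ countFin-mono (λ k → F⊆Estar (inj₂ j) j-cov k j) ⟩
      countFin (λ k → Estar Mg F k j)    ∎)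
      where
      open ≤-Reasoning
      in-col-j : ∀ y k → F (inj₂ j) k y ≡ true → y ≡ j
      in-col-j y k p = sym (≟-true⁻ (proj₂ (∧-true⁻ (F⊆edgesAt (inj₂ j) j-cov k y p))))

mainTheorem4 : ∀ {n₁ n₂ : ℕ} (E : EdgeSet n₁ n₂) (κ : ℕ) → MaxMatchingCard E κ
    → (Mg : EdgeSet n₁ n₂) → IsMaximalMatching E Mg
    → (F : Vertex n₁ n₂ → EdgeSet n₁ n₂)
    → (∀ v → covered Mg v ≡ true → ValidF E Mg v (F v))
    → MaxMatchingCard (Estar Mg F) κ
mainTheorem4 E κ ((M , matching , |M|≡κ) , maximum) Mg maximal F valid
  with matching-into-subgraph (Estar⊆E maximal F valid) (2 * card Mg) (Estar-dense maximal F valid)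
                              matching (matching-card≤2κg maximal matching)
... | M* , matching* , |M*|≡|M| =
  (M* , matching* , trans |M*|≡|M| |M|≡κ) ,
  λ N N-matching → maximum N (IsMatching-mono (Estar⊆E maximal F valid) N-matching)
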